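{- For every $k\ge3$ there is a graph $G$ with $\mathrm{cstw}(G)\le3$ and $\mathrm{ctdw}(G)\ge k$.
   Context: A strong tree decomposition of $G=(V,E)$ is $(\{X_i\}_{i\in I},T=(I,F))$ where $\{X_i\}$ partitions $V$ and $T$ is a tree such that each edge has both ends in one bag or in bags of two adjacent tree nodes; its width is the maximum bag size. $\mathrm{cstw}(G)$ (connected strong tree width) is the minimum width of a strong tree decomposition in which each bag induces a connected subgraph. A tree distance decomposition is a strong tree decomposition with root $r$ such that each $v\in X_i$, $i\neq r$, has a neighbor in the bag of the parent of $i$; $\mathrm{ctdw}(G)$ (root-connected tree distance width) is the minimum width of a tree distance decomposition whose root bag induces a connected subgraph. -}

module Defs where

open import Data.Nat using (ℕ; zero; suc; _≤_)
open import Data.Fin using (Fin)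
open import Data.Fin.Properties using (_≟_)
open import Data.Bool using (Bool; true; false)
open import Data.List using (length; filter; allFin)
open import Data.Product using (Σ; ∃; _×_)
open import Data.Sum using (_⊎_)
open import Relation.Binary.PropositionalEquality using (_≡_; _≢_)

record Graph : Set where
  field
    n     : ℕ
    adj   : Fin n → Fin n → Bool
    sym   : ∀ u v → adj u v ≡ adj v u
    irref : ∀ u → adj u u ≡ false
open Graph public

Adj : (G : Graph) → Fin (n G) → Fin (n G) → Set
Adj G u v = adj G u v ≡ true

data PathIn (G : Graph) (P : Fin (n G) → Set) : Fin (n G) → Fin (n G) → Set where
  here : ∀ {u} → P u → PathIn G P u u
  step : ∀ {u w v} → P u → Adj G u w → PathIn G P w v → PathIn G P u v

InducedConnected : (G : Graph) → (Fin (n G) → Set) → Set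
InducedConnected G P = ∀ u v → P u → P v → PathIn G P u v

iter : ∀ {A : Set} → (A → A) → ℕ → A → A
iter f zero    a = a
iter f (suc k) a = f (iter f k a)

-- A (rooted) tree on the node set Fin m, given by a parent function:
-- the root is its own parent and every node reaches the root by
-- iterating the parent map.  Every finite tree arises this way.
record Tree (m : ℕ) : Set where
  field
    root      : Fin m
    parent    : Fin m → Fin m
    root-fix  : parent root ≡ root
    reach     : ∀ i → ∃ λ k → iter parent k i ≡ root
open Tree public

TreeAdj : ∀ {m} → Tree m → Fin m → Fin m → Set
TreeAdj T i j = (i ≢ j × parent T i ≡ j) ⊎ (i ≢ j × parent T j ≡ i)

-- A strong tree decomposition of G: bags {v | bag v ≡ i}, i : Fin m,
-- partition V (every bag nonempty), each edge inside a bag or between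
-- bags of adjacent tree nodes.
record STD (G : Graph) : Set where
  field
    m        : ℕ
    tree     : Tree m
    bag      : Fin (n G) → Fin m
    nonempty : ∀ i → ∃ λ v → bag v ≡ i
    edges    : ∀ u v → Adj G u v → bag u ≡ bag v ⊎ TreeAdj tree (bag u) (bag v)
open STD public

bagSize : ∀ {G} → (D : STD G) → Fin (m D) → ℕ
bagSize {G} D i = length (filter (λ v → bag D v ≟ i) (allFin (n G)))

WidthAtMost : ∀ {G} → STD G → ℕ → Set
WidthAtMost D w = ∀ i → bagSize D i ≤ w

ConnectedBags : ∀ {G} → STD G → Set
ConnectedBags {G} D = ∀ i → InducedConnected G (λ v → bag D v ≡ i)

IsTDD : ∀ {G} → STD G → Set
IsTDD {G} D = ∀ v → bag D v ≢ root (tree D) →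
  ∃ λ u → bag D u ≡ parent (tree D) (bag D v) × Adj G v u

RootConnected : ∀ {G} → STD G → Set
RootConnected {G} D = InducedConnected G (λ v → bag D v ≡ root (tree D))

cstw≤ : Graph → ℕ → Set
cstw≤ G w = Σ (STD G) λ D → ConnectedBags D × WidthAtMost D w

-- ctdw(G) ≥ k : ctdw(G) is defined (a root-connected tree distance
-- decomposition exists) and every such decomposition has a bag of size ≥ k.
ctdw≥ : Graph → ℕ → Set
ctdw≥ G k =
  (Σ (STD G) λ D → IsTDD D × RootConnected D) ×
  (∀ (D : STD G) → IsTDD D → RootConnected D → ∃ λ i → k ≤ bagSize D i)

-- G_k has a centre adjacent to hubs h_g (g < k); gadget g is the complete bipartite
-- graph between {h_g, x_g} (hub and tip) and the mids {m_g0, …, m_g(k-1)}.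
--
-- The bags {centre}, {h_g, x_g, m_g0} below it and {m_gi} (i > 0) below that are
-- connected and have at most 3 vertices.
--
-- Let D be any tree distance decomposition and δ v the depth of the bag of v.
-- Adjacent vertices differ in δ by at most one, and every vertex outside the root
-- bag has a neighbour one level up.  If no interior vertex x_g, m_gi of gadget g is
-- in the root bag, the climb from the interior must leave it through h_g, so
-- δ h_g < δ v on the interior; hence δ m_gi = δ h_g + 1 for all i, and δ x_g is
-- δ h_g + 1 or δ h_g + 2.  As x_g is adjacent to every m_gi, all m_gi then share a
-- bag: that of x_g, or its parent.  Otherwise every gadget has an interior vertex
-- in the root bag.  Either way some bag has k vertices.

module Submission where

open import Defs hiding (sym; n; m)
open import Data.Nat using (ℕ; zero; suc; _≤_; _<_; _*_)
import Data.Nat.Properties as ℕ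
open import Data.Fin using (Fin; zero; suc; combine; remQuot)
import Data.Fin.Properties as Fin
open import Data.Product using (Σ; ∃; _×_; _,_; proj₁; proj₂; uncurry)
open import Data.Sum using (_⊎_; inj₁; inj₂)
open import Data.Bool using (true)
open import Data.Unit using (⊤; tt)
open import Data.Empty using (⊥-elim)
open import Data.List using (List; _∷_; length; filter; allFin; lookup)
open import Data.List.Membership.Propositional using (_∈_)
open import Data.List.Membership.Propositional.Properties
  using (∈-filter⁺; ∈-filter⁻; ∈-lookup; ∈-allFin)
open import Data.List.Relation.Unary.Any as Any using ()
open import Data.List.Relation.Unary.Any.Properties using (lookup-index)
import Data.List.Relation.Unary.All as All
open import Data.List.Relation.Unary.AllPairs using (_∷_)
open import Data.List.Relation.Unary.Unique.Propositional using (Unique)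
open import Data.List.Relation.Unary.Unique.Propositional.Properties using (filter⁺; allFin⁺)
open import Function using (_∘_)
open import Function.Bundles using (mk⇔)
open import Function.Definitions using (Injective)
open import Relation.Nullary using (¬_; Dec; yes; no; does; map′)
open import Relation.Nullary.Decidable using (dec-true; dec-false; does-⇔)
open import Relation.Unary using (Decidable)
open import Relation.Binary.PropositionalEquality

Unique⇒lookup-injective : ∀ {A : Set} {xs : List A} → Unique xs →
  ∀ p q → lookup xs p ≡ lookup xs q → p ≡ q
Unique⇒lookup-injective (_  ∷ _) zero    zero    _ = refl
Unique⇒lookup-injective (x∉ ∷ _) zero    (suc q) e = ⊥-elim (All.lookup x∉ (∈-lookup q) e)
Unique⇒lookup-injective (x∉ ∷ _) (suc p) zero    e = ⊥-elim (All.lookup x∉ (∈-lookup p) (sym e))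
Unique⇒lookup-injective (_  ∷ u) (suc p) (suc q) e = cong suc (Unique⇒lookup-injective u p q e)

module _ {n : ℕ} {P : Fin n → Set} (P? : Decidable P) where

  satisfying : List (Fin n)
  satisfying = filter P? (allFin n)

  count : ℕ
  count = length satisfying

  injective⇒≤count : ∀ {a} (e : Fin a → Fin n) → Injective _≡_ _≡_ e →
                     (∀ x → P (e x)) → a ≤ count
  injective⇒≤count {a} e e-injective Pe = Fin.injective⇒≤ {f = position} position-injective
    where
    selected : ∀ x → e x ∈ satisfying
    selected x = ∈-filter⁺ P? (∈-allFin (e x)) (Pe x)

    position : Fin a → Fin count
    position x = Any.index (selected x)

    position-injective : Injective _≡_ _≡_ position
    position-injective {x} {y} eq = e-injective (begin
      e x                            ≡⟨ lookup-index (selected x) ⟩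
      lookup satisfying (position x) ≡⟨ cong (lookup satisfying) eq ⟩
      lookup satisfying (position y) ≡⟨ lookup-index (selected y) ⟨
      e y                            ∎)
      where open ≡-Reasoning

  covered⇒count≤ : ∀ {a} (f : Fin a → Fin n) → (∀ v → P v → ∃ λ x → f x ≡ v) →
                   count ≤ a
  covered⇒count≤ f cover = Fin.injective⇒≤ {f = proj₁ ∘ preimage} preimage-injective
    where
    preimage : ∀ p → ∃ λ x → f x ≡ lookup satisfying p
    preimage p = cover (lookup satisfying p) (proj₂ (∈-filter⁻ P? {xs = allFin n} (∈-lookup p)))

    preimage-injective : Injective _≡_ _≡_ (proj₁ ∘ preimage)
    preimage-injective {p} {q} eq = Unique⇒lookup-injective (filter⁺ P? (allFin⁺ n)) p q
      (trans (sym (proj₂ (preimage p))) (trans (cong f eq) (proj₂ (preimage q))))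

iter-suc : ∀ {A : Set} (f : A → A) k a → iter f (suc k) a ≡ iter f k (f a)
iter-suc f zero    a = refl
iter-suc f (suc k) a = cong f (iter-suc f k a)

module TreeDepth {m} (T : Tree m) where

  data Depth : Fin m → ℕ → Set where
    root-depth  : Depth (root T) 0
    child-depth : ∀ {i d} → i ≢ root T → Depth (parent T i) d → Depth i (suc d)

  Depth-functional : ∀ {i d d′} → Depth i d → Depth i d′ → d ≡ d′
  Depth-functional root-depth        root-depth        = refl
  Depth-functional root-depth        (child-depth i≢ _) = ⊥-elim (i≢ refl)
  Depth-functional (child-depth i≢ _) root-depth        = ⊥-elim (i≢ refl)
  Depth-functional (child-depth _ p)  (child-depth _ q)  = cong suc (Depth-functional p q)

  reach⇒Depth : ∀ k i → iter (parent T) k i ≡ root T → ∃ (Depth i)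
  reach⇒Depth k i reach with i Fin.≟ root T
  ... | yes refl = 0 , root-depth
  reach⇒Depth zero    i reach | no i≢ = ⊥-elim (i≢ reach)
  reach⇒Depth (suc k) i reach | no i≢ with reach⇒Depth k (parent T i) (trans (sym (iter-suc _ k i)) reach)
  ... | d , p = suc d , child-depth i≢ p

  opaque
    depth : Fin m → ℕ
    depth i = proj₁ (reach⇒Depth (proj₁ (reach T i)) i (proj₂ (reach T i)))

    Depth-depth : ∀ i → Depth i (depth i)
    Depth-depth i = proj₂ (reach⇒Depth (proj₁ (reach T i)) i (proj₂ (reach T i)))

  depth-parent : ∀ {i} → i ≢ root T → depth i ≡ suc (depth (parent T i))
  depth-parent {i} i≢ = Depth-functional (Depth-depth i) (child-depth i≢ (Depth-depth (parent T i)))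

  depth≡0⇒root : ∀ i → depth i ≡ 0 → i ≡ root T
  depth≡0⇒root i d≡0 with i Fin.≟ root T
  ... | yes i≡ = i≡
  ... | no  i≢ = ⊥-elim (ℕ.0≢1+n (trans (sym d≡0) (depth-parent i≢)))

  child⇒depth-suc : ∀ {i j} → i ≢ j → parent T i ≡ j → depth i ≡ suc (depth j)
  child⇒depth-suc {i} i≢j pi≡j = trans (depth-parent i≢root) (cong (suc ∘ depth) pi≡j)
    where
    i≢root : i ≢ root T
    i≢root refl = i≢j (trans (sym (root-fix T)) pi≡j)

module BagDepth {G : Graph} (D : STD G) where
  open TreeDepth (tree D) public

  bagDepth : Fin (Graph.n G) → ℕ
  bagDepth v = depth (bag D v)

  bagDepth-adjacent-≤ : ∀ {u v} → Adj G u v → bagDepth u ≤ suc (bagDepth v)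
  bagDepth-adjacent-≤ {u} {v} a with edges D u v a
  ... | inj₁ same            = ℕ.m≤n⇒m≤1+n (ℕ.≤-reflexive (cong depth same))
  ... | inj₂ (inj₁ (ne , p)) = ℕ.≤-reflexive (child⇒depth-suc ne p)
  ... | inj₂ (inj₂ (ne , p)) =
    ℕ.m≤n⇒m≤1+n (ℕ.<⇒≤ (ℕ.≤-reflexive (sym (child⇒depth-suc (ne ∘ sym) p))))

  adjacent-same-depth⇒same-bag : ∀ {u v} → Adj G u v → bagDepth u ≡ bagDepth v → bag D u ≡ bag D v
  adjacent-same-depth⇒same-bag {u} {v} a e with edges D u v a
  ... | inj₁ same            = same
  ... | inj₂ (inj₁ (ne , p)) = ⊥-elim (ℕ.1+n≢n (trans (sym (child⇒depth-suc ne p)) e))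
  ... | inj₂ (inj₂ (ne , p)) =
    ⊥-elim (ℕ.1+n≢n (trans (sym (child⇒depth-suc (ne ∘ sym) p)) (sym e)))

  adjacent-deeper⇒parent-bag : ∀ {u v} → Adj G u v → bagDepth u ≡ suc (bagDepth v) →
                               parent (tree D) (bag D u) ≡ bag D v
  adjacent-deeper⇒parent-bag {u} {v} a e with edges D u v a
  ... | inj₁ same            = ⊥-elim (ℕ.1+n≢n (trans (sym e) (cong depth same)))
  ... | inj₂ (inj₁ (_ , p))  = p
  ... | inj₂ (inj₂ (ne , p)) =
    ⊥-elim (ℕ.m+1+n≢n 1 (sym (trans e (cong suc (child⇒depth-suc (ne ∘ sym) p)))))

  IsTDD⇒descend : IsTDD D → ∀ v → bag D v ≢ root (tree D) →
                  ∃ λ u → Adj G v u × bagDepth v ≡ suc (bagDepth u)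
  IsTDD⇒descend tdd v v∉root with tdd v v∉root
  ... | u , bag-u , a = u , a , trans (depth-parent v∉root) (cong (suc ∘ depth) (sym bag-u))

module _ {G : Graph} {P : Fin (Graph.n G) → Set} where

  PathIn-source : ∀ {u v} → PathIn G P u v → P u
  PathIn-source (here pu)     = pu
  PathIn-source (step pu _ _) = pu

  _++ᵖ_ : ∀ {u w v} → PathIn G P u w → PathIn G P w v → PathIn G P u v
  here _       ++ᵖ q = q
  step pu a p  ++ᵖ q = step pu a (p ++ᵖ q)

  PathIn-reverse : ∀ {u v} → PathIn G P u v → PathIn G P v u
  PathIn-reverse (here pu)       = here pu
  PathIn-reverse (step pu a p) =
    PathIn-reverse p ++ᵖ step (PathIn-source p) (trans (Graph.sym G _ _) a) (here pu)

  PathIn-map : ∀ {Q : Fin (Graph.n G) → Set} → (∀ {v} → P v → Q v) →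
               ∀ {u v} → PathIn G P u v → PathIn G Q u v
  PathIn-map f (here pu)     = here (f pu)
  PathIn-map f (step pu a p) = step (f pu) a (PathIn-map f p)

  centred⇒InducedConnected : (c : Fin (Graph.n G) → Fin (Graph.n G)) →
    (∀ u v → P u → P v → c u ≡ c v) → (∀ u → P u → PathIn G P u (c u)) →
    InducedConnected G P
  centred⇒InducedConnected c c-const to-c u v pu pv =
    to-c u pu ++ᵖ subst (λ w → PathIn G P w v) (c-const v u pv pu) (PathIn-reverse (to-c v pv))

trivialTree : Tree 1
trivialTree = record
  { root = zero ; parent = λ _ → zero ; root-fix = refl ; reach = λ { zero → 0 , refl } }

module _ (G : Graph) (v₀ : Fin (Graph.n G)) where

  singleBag : STD G
  singleBag = record { m = 1 ; tree = trivialTree ; bag = λ _ → zero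
                     ; nonempty = λ { zero → v₀ , refl } ; edges = λ _ _ _ → inj₁ refl }

  singleBag-IsTDD : IsTDD singleBag
  singleBag-IsTDD v v∉root = ⊥-elim (v∉root refl)

  singleBag-RootConnected : InducedConnected G (λ _ → ⊤) → RootConnected singleBag
  singleBag-RootConnected conn u v _ _ = PathIn-map (λ _ → refl) (conn u v tt tt)

data Vertex (k : ℕ) : Set where
  centre   : Vertex k
  hub tip  : Fin k → Vertex k
  mid      : Fin k → Fin k → Vertex k

data Edge {k} : Vertex k → Vertex k → Set where
  centre-hub : ∀ {g}   → Edge centre (hub g)
  hub-centre : ∀ {g}   → Edge (hub g) centre
  hub-mid    : ∀ {g i} → Edge (hub g) (mid g i)
  mid-hub    : ∀ {g i} → Edge (mid g i) (hub g)
  tip-mid    : ∀ {g i} → Edge (tip g) (mid g i)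
  mid-tip    : ∀ {g i} → Edge (mid g i) (tip g)

Edge-sym : ∀ {k} {a b : Vertex k} → Edge a b → Edge b a
Edge-sym centre-hub = hub-centre
Edge-sym hub-centre = centre-hub
Edge-sym hub-mid    = mid-hub
Edge-sym mid-hub    = hub-mid
Edge-sym tip-mid    = mid-tip
Edge-sym mid-tip    = tip-mid

Edge-irreflexive : ∀ {k} {a : Vertex k} → ¬ Edge a a
Edge-irreflexive ()

edge? : ∀ {k} (a b : Vertex k) → Dec (Edge a b)
edge? centre    centre    = no λ ()
edge? centre    (hub _)   = yes centre-hub
edge? centre    (tip _)   = no λ ()
edge? centre    (mid _ _) = no λ ()
edge? (hub _)   centre    = yes hub-centre
edge? (hub _)   (hub _)   = no λ ()
edge? (hub _)   (tip _)   = no λ ()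
edge? (hub g)   (mid h _) = map′ (λ { refl → hub-mid }) (λ { hub-mid → refl }) (g Fin.≟ h)
edge? (tip _)   centre    = no λ ()
edge? (tip _)   (hub _)   = no λ ()
edge? (tip _)   (tip _)   = no λ ()
edge? (tip g)   (mid h _) = map′ (λ { refl → tip-mid }) (λ { tip-mid → refl }) (g Fin.≟ h)
edge? (mid _ _) centre    = no λ ()
edge? (mid g _) (hub h)   = map′ (λ { refl → mid-hub }) (λ { mid-hub → refl }) (g Fin.≟ h)
edge? (mid g _) (tip h)   = map′ (λ { refl → mid-tip }) (λ { mid-tip → refl }) (g Fin.≟ h)
edge? (mid _ _) (mid _ _) = no λ ()

module _ {k : ℕ} where

  fromGadget : Fin k × Fin (suc (suc k)) → Vertex k
  fromGadget (g , zero)        = hub g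
  fromGadget (g , suc zero)    = tip g
  fromGadget (g , suc (suc i)) = mid g i

  encode : Vertex k → Fin (suc (k * suc (suc k)))
  encode centre    = zero
  encode (hub g)   = suc (combine g zero)
  encode (tip g)   = suc (combine g (suc zero))
  encode (mid g i) = suc (combine g (suc (suc i)))

  decode : Fin (suc (k * suc (suc k))) → Vertex k
  decode zero    = centre
  decode (suc j) = fromGadget (remQuot (suc (suc k)) j)

  decode-encode : ∀ a → decode (encode a) ≡ a
  decode-encode centre    = refl
  decode-encode (hub g)   = cong fromGadget (Fin.remQuot-combine g zero)
  decode-encode (tip g)   = cong fromGadget (Fin.remQuot-combine g (suc zero))
  decode-encode (mid g i) = cong fromGadget (Fin.remQuot-combine g (suc (suc i)))

  encode-fromGadget : ∀ p → encode (fromGadget p) ≡ suc (uncurry combine p)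
  encode-fromGadget (g , zero)        = refl
  encode-fromGadget (g , suc zero)    = refl
  encode-fromGadget (g , suc (suc i)) = refl

  encode-decode : ∀ u → encode (decode u) ≡ u
  encode-decode zero    = refl
  encode-decode (suc j) = trans (encode-fromGadget (remQuot (suc (suc k)) j))
                                (cong suc (Fin.combine-remQuot {k} (suc (suc k)) j))

  encode-injective : Injective _≡_ _≡_ encode
  encode-injective {a} {b} e =
    trans (sym (decode-encode a)) (trans (cong decode e) (decode-encode b))

Gk : ℕ → Graph
Gk k = record
  { n     = suc (k * suc (suc k))
  ; adj   = λ u v → does (edge? (decode {k} u) (decode {k} v))
  ; sym   = λ u v → does-⇔ (mk⇔ Edge-sym Edge-sym)
                      (edge? (decode {k} u) (decode {k} v)) (edge? (decode {k} v) (decode {k} u))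
  ; irref = λ u → dec-false (edge? (decode {k} u) (decode {k} u)) Edge-irreflexive
  }

module _ {k : ℕ} where

  Edge⇒Adj : ∀ {a b : Vertex k} → Edge a b → Adj (Gk k) (encode a) (encode b)
  Edge⇒Adj {a} {b} e = subst₂ (λ a′ b′ → does (edge? a′ b′) ≡ true)
    (sym (decode-encode a)) (sym (decode-encode b)) (dec-true (edge? a b) e)

  Adj⇒Edge : ∀ u v → Adj (Gk k) u v → Edge (decode {k} u) (decode {k} v)
  Adj⇒Edge u v a with edge? (decode {k} u) (decode {k} v)
  Adj⇒Edge u v a  | yes e = e
  Adj⇒Edge u v () | no _

  Adj⇒Edge-encode : ∀ (a : Vertex k) u → Adj (Gk k) (encode a) u → Edge a (decode u)
  Adj⇒Edge-encode a u adj =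
    subst (λ a′ → Edge a′ (decode u)) (decode-encode a) (Adj⇒Edge (encode a) u adj)

Gk-connected : ∀ k → InducedConnected (Gk (suc k)) (λ _ → ⊤)
Gk-connected k = centred⇒InducedConnected (λ _ → encode {suc k} centre) (λ _ _ _ _ → refl) to-centre
  where
  Walk : Fin (Graph.n (Gk (suc k))) → Fin (Graph.n (Gk (suc k))) → Set
  Walk = PathIn (Gk (suc k)) (λ _ → ⊤)

  via : ∀ {a b : Vertex (suc k)} {v} → Edge a b → Walk (encode b) v → Walk (encode a) v
  via e = step tt (Edge⇒Adj e)

  to-centre′ : ∀ (a : Vertex (suc k)) → Walk (encode a) (encode {suc k} centre)
  to-centre′ centre    = here tt
  to-centre′ (hub g)   = via (hub-centre {g = g}) (here tt)
  to-centre′ (mid g i) = via (mid-hub {g = g} {i}) (to-centre′ (hub g))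
  to-centre′ (tip g)   =
    via (tip-mid {g = g} {zero}) (via (mid-hub {g = g} {zero}) (to-centre′ (hub g)))

  to-centre : ∀ u → ⊤ → Walk u (encode {suc k} centre)
  to-centre u _ = subst (λ u′ → Walk u′ _) (encode-decode {suc k} u) (to-centre′ (decode u))

data Node (k : ℕ) : Set where
  top  : Node k
  node : Fin k → Fin k → Node k

module UpperBound (k : ℕ) where
  private
    K : ℕ
    K = suc k

  parentNode : Node K → Node K
  parentNode top              = top
  parentNode (node g zero)    = top
  parentNode (node g (suc _)) = node g zero

  parentNode²≡top : ∀ x → parentNode (parentNode x) ≡ top
  parentNode²≡top top              = refl
  parentNode²≡top (node g zero)    = refl
  parentNode²≡top (node g (suc _)) = refl

  encodeNode : Node K → Fin (suc (K * K))
  encodeNode top        = zero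
  encodeNode (node g r) = suc (combine g r)

  decodeNode : Fin (suc (K * K)) → Node K
  decodeNode zero    = top
  decodeNode (suc j) = uncurry node (remQuot K j)

  decodeNode-encodeNode : ∀ x → decodeNode (encodeNode x) ≡ x
  decodeNode-encodeNode top        = refl
  decodeNode-encodeNode (node g r) = cong (uncurry node) (Fin.remQuot-combine g r)

  encodeNode-decodeNode : ∀ i → encodeNode (decodeNode i) ≡ i
  encodeNode-decodeNode zero    = refl
  encodeNode-decodeNode (suc j) = cong suc (Fin.combine-remQuot {K} K j)

  encodeNode-injective : Injective _≡_ _≡_ encodeNode
  encodeNode-injective {x} {y} e =
    trans (sym (decodeNode-encodeNode x)) (trans (cong decodeNode e) (decodeNode-encodeNode y))

  nodeTree : Tree (suc (K * K))
  nodeTree = record { root = zero ; parent = encodeNode ∘ parentNode ∘ decodeNode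
                    ; root-fix = refl ; reach = λ i → 2 , grandparent≡root i }
    where
    grandparent≡root : ∀ i → iter (encodeNode ∘ parentNode ∘ decodeNode) 2 i ≡ zero
    grandparent≡root i = trans (cong (encodeNode ∘ parentNode) (decodeNode-encodeNode _))
                               (cong encodeNode (parentNode²≡top _))

  parent-encodeNode : ∀ x → parent nodeTree (encodeNode x) ≡ encodeNode (parentNode x)
  parent-encodeNode x = cong (encodeNode ∘ parentNode) (decodeNode-encodeNode x)

  Linked : Node K → Node K → Set
  Linked x y = x ≡ y ⊎ (x ≢ y × parentNode x ≡ y) ⊎ (x ≢ y × parentNode y ≡ x)

  Linked-sym : ∀ {x y} → Linked x y → Linked y x
  Linked-sym (inj₁ x≡y)               = inj₁ (sym x≡y)
  Linked-sym (inj₂ (inj₁ (x≢y , p))) = inj₂ (inj₂ (x≢y ∘ sym , p))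
  Linked-sym (inj₂ (inj₂ (x≢y , p))) = inj₂ (inj₁ (x≢y ∘ sym , p))

  Linked⇒TreeAdj : ∀ {x y} → Linked x y →
    encodeNode x ≡ encodeNode y ⊎ TreeAdj nodeTree (encodeNode x) (encodeNode y)
  Linked⇒TreeAdj (inj₁ x≡y) = inj₁ (cong encodeNode x≡y)
  Linked⇒TreeAdj {x} (inj₂ (inj₁ (x≢y , p))) =
    inj₂ (inj₁ (x≢y ∘ encodeNode-injective , trans (parent-encodeNode x) (cong encodeNode p)))
  Linked⇒TreeAdj {y = y} (inj₂ (inj₂ (x≢y , p))) =
    inj₂ (inj₂ (x≢y ∘ encodeNode-injective , trans (parent-encodeNode y) (cong encodeNode p)))

  bagNode : Vertex K → Node K
  bagNode centre    = top
  bagNode (hub g)   = node g zero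
  bagNode (tip g)   = node g zero
  bagNode (mid g r) = node g r

  head-Linked : ∀ g r → Linked (node g zero) (node g r)
  head-Linked g zero    = inj₁ refl
  head-Linked g (suc r) = inj₂ (inj₂ ((λ ()) , refl))

  Edge⇒Linked : ∀ {a b} → Edge a b → Linked (bagNode a) (bagNode b)
  Edge⇒Linked centre-hub        = inj₂ (inj₂ ((λ ()) , refl))
  Edge⇒Linked hub-centre        = inj₂ (inj₁ ((λ ()) , refl))
  Edge⇒Linked (hub-mid {g} {i}) = head-Linked g i
  Edge⇒Linked (mid-hub {g} {i}) = Linked-sym (head-Linked g i)
  Edge⇒Linked (tip-mid {g} {i}) = head-Linked g i
  Edge⇒Linked (mid-tip {g} {i}) = Linked-sym (head-Linked g i)

  members : Node K → Fin 3 → Vertex K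
  members top        _                = centre
  members (node g r) zero             = hub g
  members (node g r) (suc zero)       = tip g
  members (node g r) (suc (suc zero)) = mid g r

  members-bagNode : ∀ a → ∃ λ x → members (bagNode a) x ≡ a
  members-bagNode centre    = zero , refl
  members-bagNode (hub g)   = zero , refl
  members-bagNode (tip g)   = suc zero , refl
  members-bagNode (mid g r) = suc (suc zero) , refl

  centreOf : Node K → Vertex K
  centreOf top        = centre
  centreOf (node g r) = mid g r

  bagNode-centreOf : ∀ x → bagNode (centreOf x) ≡ x
  bagNode-centreOf top        = refl
  bagNode-centreOf (node g r) = refl

  bagIndex : Fin (Graph.n (Gk K)) → Fin (suc (K * K))
  bagIndex = encodeNode ∘ bagNode ∘ decode

  bagIndex-encode : ∀ a → bagIndex (encode a) ≡ encodeNode (bagNode a)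
  bagIndex-encode a = cong (encodeNode ∘ bagNode) (decode-encode a)

  D₃ : STD (Gk K)
  D₃ = record
    { m        = suc (K * K)
    ; tree     = nodeTree
    ; bag      = bagIndex
    ; nonempty = λ i → encode (centreOf (decodeNode i)) , bag-centre i
    ; edges    = λ u v a → Linked⇒TreeAdj (Edge⇒Linked {decode u} {decode v} (Adj⇒Edge u v a))
    }
    where
    bag-centre : ∀ i → bagIndex (encode (centreOf (decodeNode i))) ≡ i
    bag-centre i = begin
      bagIndex (encode (centreOf (decodeNode i)))  ≡⟨ bagIndex-encode _ ⟩
      encodeNode (bagNode (centreOf (decodeNode i))) ≡⟨ cong encodeNode (bagNode-centreOf _) ⟩
      encodeNode (decodeNode i)                    ≡⟨ encodeNode-decodeNode i ⟩
      i                                            ∎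
      where open ≡-Reasoning

  D₃-width : WidthAtMost D₃ 3
  D₃-width i = covered⇒count≤ (λ v → bag D₃ v Fin.≟ i) (encode ∘ members (decodeNode i)) cover
    where
    cover : ∀ u → bag D₃ u ≡ i → ∃ λ x → encode (members (decodeNode i) x) ≡ u
    cover u u∈i with members-bagNode (decode u)
    ... | x , member-x = x , (begin
      encode (members (decodeNode i) x)         ≡⟨ cong (λ y → encode (members y x)) node-u ⟩
      encode (members (bagNode (decode u)) x)   ≡⟨ cong encode member-x ⟩
      encode (decode u)                         ≡⟨ encode-decode u ⟩
      u                                         ∎)
      where
      open ≡-Reasoning
      node-u : decodeNode i ≡ bagNode (decode u)
      node-u = trans (cong decodeNode (sym u∈i)) (decodeNode-encodeNode _)

  InBag : Node K → Fin (Graph.n (Gk K)) → Set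
  InBag x u = bag D₃ u ≡ encodeNode x

  path-to-centreOf : ∀ a →
    PathIn (Gk K) (InBag (bagNode a)) (encode a) (encode (centreOf (bagNode a)))
  path-to-centreOf centre    = here (bagIndex-encode centre)
  path-to-centreOf (hub g)   =
    step (bagIndex-encode (hub g)) (Edge⇒Adj (hub-mid {g = g} {zero})) (here (bagIndex-encode (mid g zero)))
  path-to-centreOf (tip g)   =
    step (bagIndex-encode (tip g)) (Edge⇒Adj (tip-mid {g = g} {zero})) (here (bagIndex-encode (mid g zero)))
  path-to-centreOf (mid g r) = here (bagIndex-encode (mid g r))

  D₃-connected : ConnectedBags D₃
  D₃-connected i = centred⇒InducedConnected centreIndex same-centre path-to-centre
    where
    centreIndex : Fin (Graph.n (Gk K)) → Fin (Graph.n (Gk K))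
    centreIndex u = encode (centreOf (bagNode (decode u)))

    same-centre : ∀ u v → bag D₃ u ≡ i → bag D₃ v ≡ i → centreIndex u ≡ centreIndex v
    same-centre _ _ u∈i v∈i = cong (encode ∘ centreOf) (encodeNode-injective (trans u∈i (sym v∈i)))

    path-to-centre : ∀ u → bag D₃ u ≡ i → PathIn (Gk K) (λ v → bag D₃ v ≡ i) u (centreIndex u)
    path-to-centre u u∈i = subst (λ j → PathIn (Gk K) (λ v → bag D₃ v ≡ j) u (centreIndex u)) u∈i
      (subst (λ u′ → PathIn (Gk K) (InBag (bagNode (decode u))) u′ (centreIndex u))
             (encode-decode u) (path-to-centreOf (decode u)))

interior : ∀ {k} → Fin k → Fin (suc k) → Vertex k
interior g zero    = tip g
interior g (suc i) = mid g i

interior-gadget-injective : ∀ {k} {g g′ : Fin k} j j′ → interior g j ≡ interior g′ j′ → g ≡ g′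
interior-gadget-injective zero    zero    refl = refl
interior-gadget-injective (suc _) (suc _) refl = refl

mid-injective : ∀ {k} {g : Fin k} {i i′} → mid g i ≡ mid g i′ → i ≡ i′
mid-injective refl = refl

interior-neighbour : ∀ {k} {g : Fin k} j {b} → Edge (interior g j) b →
                     b ≡ hub g ⊎ ∃ λ j′ → b ≡ interior g j′
interior-neighbour zero    (tip-mid {i = i}) = inj₂ (suc i , refl)
interior-neighbour (suc _) mid-hub           = inj₁ refl
interior-neighbour (suc _) mid-tip           = inj₂ (zero , refl)

module LowerBound {k : ℕ} (D : STD (Gk k)) (tdd : IsTDD D) where
  open BagDepth D

  level : Vertex k → ℕ
  level a = bagDepth (encode a)

  module Gadget (g : Fin k) (interior∉root : ∀ j → bag D (encode (interior g j)) ≢ root (tree D)) where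

    descend-interior : ∀ j → ∃ λ b → (b ≡ hub g ⊎ ∃ λ j′ → b ≡ interior g j′) ×
                                     level (interior g j) ≡ suc (level b)
    descend-interior j with IsTDD⇒descend tdd _ (interior∉root j)
    ... | u , a , deeper =
      decode u ,
      interior-neighbour j (Adj⇒Edge-encode (interior g j) u a) ,
      trans deeper (cong (suc ∘ bagDepth) (sym (encode-decode u)))

    hub<interior : ∀ j → level (hub g) < level (interior g j)
    hub<interior j = below _ j refl
      where
      below : ∀ d j → level (interior g j) ≡ d → level (hub g) < level (interior g j)
      below zero j at-root = ⊥-elim (interior∉root j (depth≡0⇒root _ at-root))
      below (suc d) j at-d with descend-interior j
      ... | _ , inj₁ refl , deeper = ℕ.≤-reflexive (sym deeper)
      ... | _ , inj₂ (j′ , refl) , deeper =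
        subst (level (hub g) <_) (sym deeper)
              (ℕ.m<n⇒m<1+n (below d j′ (ℕ.suc-injective (trans (sym deeper) at-d))))

    level-mid : ∀ i → level (mid g i) ≡ suc (level (hub g))
    level-mid i =
      ℕ.≤-antisym (bagDepth-adjacent-≤ (Edge⇒Adj (mid-hub {g = g} {i}))) (hub<interior (suc i))

    mids-share-bag : ∃ λ B → ∀ i → bag D (encode (mid g i)) ≡ B
    mids-share-bag with level (tip g) ℕ.≟ suc (level (hub g))
    ... | yes tip-level = bag D (encode (tip g)) , λ i →
      sym (adjacent-same-depth⇒same-bag (Edge⇒Adj (tip-mid {g = g} {i}))
                                        (trans tip-level (sym (level-mid i))))
    ... | no  tip-level = parent (tree D) (bag D (encode (tip g))) , λ i →
      sym (adjacent-deeper⇒parent-bag (Edge⇒Adj (tip-mid {g = g} {i})) (tip-two-below i))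
      where
      tip-two-below : ∀ i → level (tip g) ≡ suc (level (mid g i))
      tip-two-below i = ℕ.≤-antisym
        (bagDepth-adjacent-≤ (Edge⇒Adj (tip-mid {g = g} {i})))
        (subst (_≤ level (tip g)) (cong suc (sym (level-mid i)))
               (ℕ.≤∧≢⇒< (hub<interior zero) (tip-level ∘ sym)))

  InteriorMeetsRoot : Fin k → Set
  InteriorMeetsRoot g = ∃ λ j → bag D (encode (interior g j)) ≡ root (tree D)

  interiorMeetsRoot? : Decidable InteriorMeetsRoot
  interiorMeetsRoot? g = Fin.any? (λ j → bag D (encode (interior g j)) Fin.≟ root (tree D))

  some-bag-≥k : ∃ λ B → k ≤ bagSize D B
  some-bag-≥k with Fin.all? interiorMeetsRoot?
  ... | yes every = root (tree D) ,
    injective⇒≤count (λ v → bag D v Fin.≟ root (tree D)) witness witness-injective (proj₂ ∘ every)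
    where
    witness : Fin k → Fin (Graph.n (Gk k))
    witness g = encode (interior g (proj₁ (every g)))

    witness-injective : Injective _≡_ _≡_ witness
    witness-injective = interior-gadget-injective _ _ ∘ encode-injective
  ... | no ¬every with Fin.¬∀⟶∃¬ k InteriorMeetsRoot interiorMeetsRoot? ¬every
  ... | g , ¬meets with Gadget.mids-share-bag g (λ j in-root → ¬meets (j , in-root))
  ... | B , mids∈B = B ,
    injective⇒≤count (λ v → bag D v Fin.≟ B) (encode ∘ mid g)
                     (mid-injective ∘ encode-injective) mids∈B

theorem9 : ∀ (k : ℕ) → 3 ≤ k → Σ Graph λ G → cstw≤ G 3 × ctdw≥ G k
theorem9 (suc k) _ =
  G , (D₃ , D₃-connected , D₃-width) ,
  (root-connected-TDD , λ D tdd _ → LowerBound.some-bag-≥k D tdd)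
  where
  open UpperBound k

  G : Graph
  G = Gk (suc k)

  root-connected-TDD : Σ (STD G) λ D → IsTDD D × RootConnected D
  root-connected-TDD = singleBag G c , singleBag-IsTDD G c , singleBag-RootConnected G c (Gk-connected k)
    where
    c : Fin (Graph.n G)
    c = encode {suc k} centre
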